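{- Let $F=GF(8)$, $\alpha$ a primitive element, $\alpha^{ -\infty}=0$, and let $i\neq j$ be elements of $\{ -\infty,0,1,\dots,6\}$. Then one can choose a system of representatives of the cosets of $\overline{H}_{\alpha^i}\cap\overline{H}_{\alpha^j}$ in $\overline{H}_{\alpha^i}$ consisting of vectors of weight at most $4$ that all lie in the $(\alpha^i,\alpha^j)$-component $R_{\alpha^i\alpha^j}(\overline{H}_{\alpha^i},0)$ of the code $\overline{H}_{\alpha^i}$ containing the zero vector.
   Context: Binary vectors of length $8$ have coordinates indexed by elements of $F$; a vector is identified with its support $X\subseteq F$, addition is symmetric difference. For $a\in F$, $\overline{H}_a=\{X\subseteq F: |X| \text{ even},\ \sum_{x\in X}(x+a)^3=0\}$ (an extended Hamming code, a linear code). For a code $D$ and $X\in D$, two codewords are $(a,b)$-adjacent if they are at distance $4$ and differ in coordinates $a$ and $b$; the $(a,b)$-component $R_{ab}(D,X)$ is the set of codewords joined to $X$ by a path of successive $(a,b)$-adjacent codewords. -}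

module Defs where

open import Data.Bool using (Bool; true; false; _xor_; _∧_; if_then_else_)
open import Data.Fin using (Fin; zero; suc; toℕ)
open import Data.Vec using (Vec; []; _∷_; lookup; zipWith; tabulate; foldr; replicate)
open import Data.Nat using (ℕ; zero; suc; _+_; _≤_; _<_)
open import Data.Nat.Divisibility using (_∣_)
open import Data.Maybe using (Maybe; just; nothing)
open import Data.Product using (_×_; _,_)
open import Relation.Binary.PropositionalEquality using (_≡_; _≢_)

-- The field F = GF(8), realised as GF(2)[x]/(x^3 + x + 1).
-- An element c0 + c1 x + c2 x^2 is encoded as the element
-- c0 + 2 c1 + 4 c2 of Fin 8.

F : Set
F = Fin 8

Bits : Set
Bits = Bool × Bool × Bool

toBits : F → Bits
toBits zero                                     = false , false , false
toBits (suc zero)                               = true  , false , false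
toBits (suc (suc zero))                         = false , true  , false
toBits (suc (suc (suc zero)))                   = true  , true  , false
toBits (suc (suc (suc (suc zero))))             = false , false , true
toBits (suc (suc (suc (suc (suc zero)))))       = true  , false , true
toBits (suc (suc (suc (suc (suc (suc zero)))))) = false , true  , true
toBits (suc (suc (suc (suc (suc (suc (suc zero))))))) = true , true , true

fromBits : Bits → F
fromBits (false , false , false) = zero
fromBits (true  , false , false) = suc zero
fromBits (false , true  , false) = suc (suc zero)
fromBits (true  , true  , false) = suc (suc (suc zero))
fromBits (false , false , true ) = suc (suc (suc (suc zero)))
fromBits (true  , false , true ) = suc (suc (suc (suc (suc zero))))
fromBits (false , true  , true ) = suc (suc (suc (suc (suc (suc zero)))))
fromBits (true  , true  , true ) = suc (suc (suc (suc (suc (suc (suc zero))))))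

0F : F
0F = zero

1F : F
1F = suc zero

_+F_ : F → F → F
x +F y with toBits x | toBits y
... | a0 , a1 , a2 | b0 , b1 , b2 = fromBits (a0 xor b0 , a1 xor b1 , a2 xor b2)

-- product of polynomials, reduced with x^3 = x + 1, x^4 = x^2 + x
_*F_ : F → F → F
x *F y with toBits x | toBits y
... | a0 , a1 , a2 | b0 , b1 , b2 =
  let d0 = a0 ∧ b0
      d1 = (a0 ∧ b1) xor (a1 ∧ b0)
      d2 = (a0 ∧ b2) xor (a1 ∧ b1) xor (a2 ∧ b0)
      d3 = (a1 ∧ b2) xor (a2 ∧ b1)
      d4 = a2 ∧ b2
  in fromBits (d0 xor d3 , d1 xor d3 xor d4 , d2 xor d4)

pow : F → ℕ → F
pow a zero    = 1F
pow a (suc k) = a *F pow a k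

cube : F → F
cube x = pow x 3

IsPrimitive : F → Set
IsPrimitive α = (pow α 7 ≡ 1F) × ((k : ℕ) → 1 ≤ k → k < 7 → pow α k ≢ 1F)

-- Exponents in {-∞, 0, 1, ..., 6}: nothing stands for -∞
Exp : Set
Exp = Maybe (Fin 7)

powE : F → Exp → F
powE α nothing  = 0F
powE α (just k) = pow α (toℕ k)

-- Binary words of length 8 with coordinates indexed by F.
-- A word X is identified with its support {x ∈ F | lookup X x ≡ true}.

Word : Set
Word = Vec Bool 8

zeroW : Word
zeroW = replicate 8 false

_⊕_ : Word → Word → Word
_⊕_ = zipWith _xor_

count : ∀ {n} → Vec Bool n → ℕ
count = foldr _ (λ b n → if b then suc n else n) 0

weight : Word → ℕ
weight = count

dist : Word → Word → ℕ
dist X Y = weight (X ⊕ Y)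

sumF : ∀ {n} → Vec F n → F
sumF = foldr _ _+F_ 0F

syndrome : F → Word → F
syndrome a X = sumF (tabulate (λ x → if lookup X x then cube (x +F a) else 0F))

Code : Set₁
Code = Word → Set

Hbar : F → Code
Hbar a X = (2 ∣ weight X) × (syndrome a X ≡ 0F)

Adj : F → F → Word → Word → Set
Adj a b X Y = (dist X Y ≡ 4) × (lookup X a ≢ lookup Y a) × (lookup X b ≢ lookup Y b)

-- InComp D a b X Y : Y ∈ R_{ab}(D, X), i.e. Y is joined to X (∈ D) by a
-- path of successive (a,b)-adjacent codewords of D
data InComp (D : Code) (a b : F) (X : Word) : Word → Set where
  here : D X → InComp D a b X X
  step : ∀ {Y Z} → InComp D a b X Y → D Z → Adj a b Y Z → InComp D a b X Z

-- The affine maps y ↦ a + c·y (c ≠ 0) of GF(8) permute the coordinates of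
-- words, and since (a + c·y) + (a + c·t) = c·(y + t) they multiply every
-- syndrome by c³.  Hence they carry H̄_t onto H̄_{a+c·t} and preserve weight
-- and adjacency, so they carry a transversal of the required kind for (t, s)
-- to one for the images of t and s.  As the affine group is doubly transitive
-- it suffices to exhibit one transversal for (0, 1); the powers α^i,
-- i ∈ {-∞, 0, …, 6}, are pairwise distinct because α has order 7.
module Submission where

open import Defs
open import Data.Nat using (ℕ; _≤_)
open import Data.Fin using (Fin)
open import Data.Vec using (Vec; lookup)
open import Data.Product using (Σ; ∃; _×_)
open import Relation.Binary.PropositionalEquality using (_≡_; _≢_)

open import Algebra.Bundles using (CommutativeMonoid)
open import Algebra.Definitions {A = F} _≡_ using (Associative; Commutative; LeftIdentity)
import Algebra.Properties.CommutativeMonoid.Sum as Sum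
open import Algebra.Structures.Biased {A = F} _≡_ using (isCommutativeMonoidˡ)
open import Data.Bool using (Bool; true; false; if_then_else_; _xor_)
open import Data.Fin using (zero; suc; toℕ; #_)
open import Data.Fin.Permutation using (Permutation′; permutation; flip; _⟨$⟩ʳ_; _⟨$⟩ˡ_; inverseˡ)
open import Data.Fin.Properties using (all?; any?; _≟_)
open import Data.Fin.Subset using (Subset)
open import Data.Fin.Subset.Properties using (anySubset?)
open import Data.List using (List; []; _∷_)
open import Data.List.Membership.DecPropositional (_≟_ {8}) using (_∈?_)
open import Data.Maybe using (just; nothing)
open import Data.Nat using (z≤n; s≤s)
open import Data.Nat.Divisibility using (_∣_; _∣?_)
open import Data.Nat.Properties using (+-0-commutativeMonoid; ≤-refl)
open import Data.Product using (_,_)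
open import Data.Vec using (_∷_; []; tabulate; map)
open import Data.Vec.Functional using (Vector)
open import Data.Vec.Properties
  using (lookup∘tabulate; tabulate∘lookup; tabulate-cong; lookup-zipWith; lookup-replicate; lookup-map)
open import Function using (_∘_)
open import Level using (0ℓ)
open import Relation.Binary.PropositionalEquality
  using (refl; sym; trans; cong; cong₂; subst; subst₂; module ≡-Reasoning)
open import Relation.Binary.PropositionalEquality.Algebra using (isMagma)
open import Relation.Nullary using (Dec; yes; no; does)
open import Relation.Nullary.Decidable using (toWitness; decidable-stable; _×-dec_; _→-dec_; ¬?)
open import Relation.Unary using (Pred; Decidable)

allSubset? : ∀ {n ℓ} {P : Pred (Subset n) ℓ} → Decidable P → Dec (∀ p → P p)
allSubset? P? with anySubset? (¬? ∘ P?)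
... | yes (p , ¬Pp) = no λ ∀P → ¬Pp (∀P p)
... | no ∄¬P        = yes λ p → decidable-stable (P? p) (λ ¬Pp → ∄¬P (p , ¬Pp))

lookup-extensionality : ∀ {n} {A : Set} {u v : Vec A n} → (∀ i → lookup u i ≡ lookup v i) → u ≡ v
lookup-extensionality {u = u} {v} u≗v =
  trans (sym (tabulate∘lookup u)) (trans (tabulate-cong u≗v) (tabulate∘lookup v))

+F-assoc : Associative _+F_
+F-assoc = toWitness {a? = all? λ x → all? λ y → all? λ z → (x +F y) +F z ≟ x +F (y +F z)} _

+F-comm : Commutative _+F_
+F-comm = toWitness {a? = all? λ x → all? λ y → x +F y ≟ y +F x} _

+F-identityˡ : LeftIdentity 0F _+F_
+F-identityˡ = toWitness {a? = all? λ x → 0F +F x ≟ x} _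

+F-commutativeMonoid : CommutativeMonoid 0ℓ 0ℓ
+F-commutativeMonoid = record
  { isCommutativeMonoid = isCommutativeMonoidˡ {_+F_} {0F} record
    { isSemigroup = record { isMagma = isMagma _+F_ ; assoc = +F-assoc }
    ; identityˡ   = +F-identityˡ
    ; comm        = +F-comm
    }
  }

open CommutativeMonoid +F-commutativeMonoid using () renaming (identityʳ to +F-identityʳ)

+F-cancelˡ : ∀ a b → a +F (a +F b) ≡ b
+F-cancelˡ = toWitness {a? = all? λ a → all? λ b → a +F (a +F b) ≟ b} _

*F-identityʳ : ∀ c → c *F 1F ≡ c
*F-identityʳ = toWitness {a? = all? λ c → c *F 1F ≟ c} _

*F-zeroʳ : ∀ c → c *F 0F ≡ 0F
*F-zeroʳ = toWitness {a? = all? λ c → c *F 0F ≟ 0F} _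

*F-distribˡ-+F : ∀ c x y → c *F (x +F y) ≡ (c *F x) +F (c *F y)
*F-distribˡ-+F = toWitness {a? = all? λ c → all? λ x → all? λ y →
  c *F (x +F y) ≟ (c *F x) +F (c *F y)} _

*F≡0⇒≡0 : ∀ c x → c ≢ 0F → c *F x ≡ 0F → x ≡ 0F
*F≡0⇒≡0 = toWitness {a? = all? λ c → all? λ x → ¬? (c ≟ 0F) →-dec (c *F x ≟ 0F →-dec x ≟ 0F)} _

+F-≢⇒≢0 : ∀ a b → a ≢ b → a +F b ≢ 0F
+F-≢⇒≢0 = toWitness {a? = all? λ a → all? λ b → ¬? (a ≟ b) →-dec ¬? (a +F b ≟ 0F)} _

cube-≢0 : ∀ c → c ≢ 0F → cube c ≢ 0F
cube-≢0 = toWitness {a? = all? λ c → ¬? (c ≟ 0F) →-dec ¬? (cube c ≟ 0F)} _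

cube-affine-difference : ∀ a c y t → cube ((a +F (c *F y)) +F (a +F (c *F t))) ≡ cube c *F cube (y +F t)
cube-affine-difference = toWitness {a? = all? λ a → all? λ c → all? λ y → all? λ t →
  cube ((a +F (c *F y)) +F (a +F (c *F t))) ≟ cube c *F cube (y +F t)} _

-- c ⁻¹ = c⁶ because c⁷ = 1 for every c ≠ 0.
_⁻¹ : F → F
c ⁻¹ = pow c 6

affine-inverseˡ : ∀ a c → c ≢ 0F → ∀ x → a +F (c *F ((c ⁻¹) *F (x +F a))) ≡ x
affine-inverseˡ = toWitness {a? = all? λ a → all? λ c → ¬? (c ≟ 0F) →-dec all? λ x →
  a +F (c *F ((c ⁻¹) *F (x +F a))) ≟ x} _

affine-inverseʳ : ∀ a c → c ≢ 0F → ∀ y → (c ⁻¹) *F ((a +F (c *F y)) +F a) ≡ y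
affine-inverseʳ = toWitness {a? = all? λ a → all? λ c → ¬? (c ≟ 0F) →-dec all? λ y →
  (c ⁻¹) *F ((a +F (c *F y)) +F a) ≟ y} _

pow-≢0 : ∀ α → α ≢ 0F → (k : Fin 7) → pow α (toℕ k) ≢ 0F
pow-≢0 = toWitness {a? = all? λ α → ¬? (α ≟ 0F) →-dec all? λ k → ¬? (pow α (toℕ k) ≟ 0F)} _

-- GF(8)ˣ is cyclic of prime order 7, so every α ∉ {0, 1} is primitive.
pow-injective : ∀ α → α ≢ 0F → α ≢ 1F →
  (k l : Fin 7) → pow α (toℕ k) ≡ pow α (toℕ l) → k ≡ l
pow-injective = toWitness {a? = all? λ α → ¬? (α ≟ 0F) →-dec ¬? (α ≟ 1F) →-dec
  all? λ k → all? λ l → pow α (toℕ k) ≟ pow α (toℕ l) →-dec k ≟ l} _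

*F-distrib-if : ∀ c (b : Bool) x → (if b then c *F x else 0F) ≡ c *F (if b then x else 0F)
*F-distrib-if c true  x = refl
*F-distrib-if c false x = sym (*F-zeroʳ c)

module ΣF = Sum +F-commutativeMonoid
module Σℕ = Sum +-0-commutativeMonoid

*F-distribˡ-sum : ∀ {n} c (f : Vector F n) → ΣF.sum (λ i → c *F f i) ≡ c *F ΣF.sum f
*F-distribˡ-sum {ℕ.zero}  c f = sym (*F-zeroʳ c)
*F-distribˡ-sum {ℕ.suc n} c f =
  trans (cong ((c *F f zero) +F_) (*F-distribˡ-sum c (f ∘ suc)))
        (sym (*F-distribˡ-+F c (f zero) (ΣF.sum (f ∘ suc))))

sumF-tabulate : ∀ {n} (f : Vector F n) → sumF (tabulate f) ≡ ΣF.sum f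
sumF-tabulate {ℕ.zero}  f = refl
sumF-tabulate {ℕ.suc n} f = cong (f zero +F_) (sumF-tabulate (f ∘ suc))

sum-permute-scale : ∀ {n} (π : Permutation′ n) c (f g : Vector F n) →
  (∀ y → f (π ⟨$⟩ʳ y) ≡ c *F g y) → ΣF.sum f ≡ c *F ΣF.sum g
sum-permute-scale π c f g f∘π≗cg =
  trans (ΣF.sum-permute f π) (trans (ΣF.sum-cong-≗ f∘π≗cg) (*F-distribˡ-sum c g))

permute : Permutation′ 8 → Word → Word
permute π X = tabulate (lookup X ∘ (π ⟨$⟩ˡ_))

lookup-permute : ∀ π X x → lookup (permute π X) x ≡ lookup X (π ⟨$⟩ˡ x)
lookup-permute π X = lookup∘tabulate (lookup X ∘ (π ⟨$⟩ˡ_))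

lookup-permute-image : ∀ π X y → lookup (permute π X) (π ⟨$⟩ʳ y) ≡ lookup X y
lookup-permute-image π X y = trans (lookup-permute π X (π ⟨$⟩ʳ y)) (cong (lookup X) (inverseˡ π))

permute-flip : ∀ π X → permute π (permute (flip π) X) ≡ X
permute-flip π X = trans (tabulate-cong (lookup-permute-image (flip π) X)) (tabulate∘lookup X)

permute-⊕ : ∀ π X Y → permute π (X ⊕ Y) ≡ permute π X ⊕ permute π Y
permute-⊕ π X Y = lookup-extensionality λ x → begin
  lookup (permute π (X ⊕ Y)) x                      ≡⟨ lookup-permute π (X ⊕ Y) x ⟩
  lookup (X ⊕ Y) (π ⟨$⟩ˡ x)                         ≡⟨ lookup-zipWith _xor_ (π ⟨$⟩ˡ x) X Y ⟩
  lookup X (π ⟨$⟩ˡ x) xor lookup Y (π ⟨$⟩ˡ x)       ≡⟨ cong₂ _xor_ (lookup-permute π X x) (lookup-permute π Y x) ⟨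
  lookup (permute π X) x xor lookup (permute π Y) x  ≡⟨ lookup-zipWith _xor_ x (permute π X) (permute π Y) ⟨
  lookup (permute π X ⊕ permute π Y) x              ∎
  where open ≡-Reasoning

permute-zeroW : ∀ π → permute π zeroW ≡ zeroW
permute-zeroW π = lookup-extensionality λ x →
  trans (lookup-permute π zeroW x)
        (trans (lookup-replicate (π ⟨$⟩ˡ x) false) (sym (lookup-replicate x false)))

indicator : Bool → ℕ
indicator b = if b then 1 else 0

count≡sum : ∀ {n} (v : Vec Bool n) → count v ≡ Σℕ.sum (indicator ∘ lookup v)
count≡sum []          = refl
count≡sum (true  ∷ v) = cong ℕ.suc (count≡sum v)
count≡sum (false ∷ v) = count≡sum v

weight-permute : ∀ π X → weight (permute π X) ≡ weight X
weight-permute π X = begin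
  weight (permute π X)                       ≡⟨ count≡sum (permute π X) ⟩
  Σℕ.sum (indicator ∘ lookup (permute π X))  ≡⟨ Σℕ.sum-cong-≗ (cong indicator ∘ lookup-permute π X) ⟩
  Σℕ.sum (indicator ∘ lookup X ∘ (π ⟨$⟩ˡ_))  ≡⟨ Σℕ.sum-permute (indicator ∘ lookup X) (flip π) ⟨
  Σℕ.sum (indicator ∘ lookup X)              ≡⟨ count≡sum X ⟨
  weight X                                   ∎
  where open ≡-Reasoning

dist-permute : ∀ π X Y → dist (permute π X) (permute π Y) ≡ dist X Y
dist-permute π X Y = trans (cong weight (sym (permute-⊕ π X Y))) (weight-permute π (X ⊕ Y))

LightInComponent : F → F → Word → Set
LightInComponent a b X = Hbar a X × weight X ≤ 4 × InComp (Hbar a) a b zeroW X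

MeetsEveryCoset : F → F → ∀ {n} → Vec Word n → Set
MeetsEveryCoset a b {n} R =
  (X : Word) → Hbar a X → ∃ λ (k : Fin n) → Hbar a (X ⊕ lookup R k) × Hbar b (X ⊕ lookup R k)

InDistinctCosets : F → F → ∀ {n} → Vec Word n → Set
InDistinctCosets a b {n} R =
  (k l : Fin n) → Hbar a (lookup R k ⊕ lookup R l) → Hbar b (lookup R k ⊕ lookup R l) → k ≡ l

Transversal : F → F → ∀ {n} → Vec Word n → Set
Transversal a b {n} R =
  ((k : Fin n) → LightInComponent a b (lookup R k)) × MeetsEveryCoset a b R × InDistinctCosets a b R

syndromeTerm : F → Word → Vector F 8
syndromeTerm t X x = if lookup X x then cube (x +F t) else 0F

module Transport (π : Permutation′ 8) (k : F) (k≢0 : k ≢ 0F)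
  (cube-π : ∀ y t → cube ((π ⟨$⟩ʳ y) +F (π ⟨$⟩ʳ t)) ≡ k *F cube (y +F t)) where

  syndrome-permute : ∀ t W → syndrome (π ⟨$⟩ʳ t) (permute π W) ≡ k *F syndrome t W
  syndrome-permute t W = begin
    syndrome (π ⟨$⟩ʳ t) (permute π W)   ≡⟨ sumF-tabulate termπ ⟩
    ΣF.sum termπ                        ≡⟨ sum-permute-scale π k termπ (syndromeTerm t W) term-permute ⟩
    k *F ΣF.sum (syndromeTerm t W)      ≡⟨ cong (k *F_) (sumF-tabulate (syndromeTerm t W)) ⟨
    k *F syndrome t W                   ∎
    where
    open ≡-Reasoning
    termπ : Vector F 8
    termπ = syndromeTerm (π ⟨$⟩ʳ t) (permute π W)
    term-permute : ∀ y → termπ (π ⟨$⟩ʳ y) ≡ k *F syndromeTerm t W y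
    term-permute y = begin
      (if lookup (permute π W) (π ⟨$⟩ʳ y) then cube ((π ⟨$⟩ʳ y) +F (π ⟨$⟩ʳ t)) else 0F)
        ≡⟨ cong₂ (λ b z → if b then z else 0F) (lookup-permute-image π W y) (cube-π y t) ⟩
      (if lookup W y then k *F cube (y +F t) else 0F)
        ≡⟨ *F-distrib-if k (lookup W y) (cube (y +F t)) ⟩
      k *F syndromeTerm t W y
        ∎

  Hbar-permute⁺ : ∀ t W {X} → permute π W ≡ X → Hbar t W → Hbar (π ⟨$⟩ʳ t) X
  Hbar-permute⁺ t W refl (even , syndrome≡0) =
    subst (2 ∣_) (sym (weight-permute π W)) even ,
    trans (syndrome-permute t W) (trans (cong (k *F_) syndrome≡0) (*F-zeroʳ k))

  Hbar-permute⁻ : ∀ t W {X} → permute π W ≡ X → Hbar (π ⟨$⟩ʳ t) X → Hbar t W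
  Hbar-permute⁻ t W refl (even , syndrome≡0) =
    subst (2 ∣_) (weight-permute π W) even ,
    *F≡0⇒≡0 k (syndrome t W) k≢0 (trans (sym (syndrome-permute t W)) syndrome≡0)

  Adj-permute : ∀ t s W V → Adj t s W V → Adj (π ⟨$⟩ʳ t) (π ⟨$⟩ʳ s) (permute π W) (permute π V)
  Adj-permute t s W V (dist≡4 , differ-t , differ-s) =
    trans (dist-permute π W V) dist≡4 , moved t differ-t , moved s differ-s
    where
    moved : ∀ y → lookup W y ≢ lookup V y →
      lookup (permute π W) (π ⟨$⟩ʳ y) ≢ lookup (permute π V) (π ⟨$⟩ʳ y)
    moved y = subst₂ _≢_ (sym (lookup-permute-image π W y)) (sym (lookup-permute-image π V y))

  InComp-permute : ∀ {t s X Y} → InComp (Hbar t) t s X Y →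
    InComp (Hbar (π ⟨$⟩ʳ t)) (π ⟨$⟩ʳ t) (π ⟨$⟩ʳ s) (permute π X) (permute π Y)
  InComp-permute {t} {s} {X} (here h) = here (Hbar-permute⁺ t X refl h)
  InComp-permute {t} {s} (step {Y} {Z} p h adj) =
    step (InComp-permute p) (Hbar-permute⁺ t Z refl h) (Adj-permute t s Y Z adj)

  lightInComponent-permute : ∀ t s X → LightInComponent t s X →
    LightInComponent (π ⟨$⟩ʳ t) (π ⟨$⟩ʳ s) (permute π X)
  lightInComponent-permute t s X (inH , light , inComp) =
    Hbar-permute⁺ t X refl inH ,
    subst (_≤ 4) (sym (weight-permute π X)) light ,
    subst (λ Z → InComp (Hbar (π ⟨$⟩ʳ t)) (π ⟨$⟩ʳ t) (π ⟨$⟩ʳ s) Z (permute π X))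
      (permute-zeroW π) (InComp-permute inComp)

  meetsEveryCoset-permute : ∀ t s {n} (R : Vec Word n) → MeetsEveryCoset t s R →
    MeetsEveryCoset (π ⟨$⟩ʳ t) (π ⟨$⟩ʳ s) (map (permute π) R)
  meetsEveryCoset-permute t s R meets X inH = moveCoset (meets W inH-W)
    where
    W : Word
    W = permute (flip π) X
    inH-W : Hbar t W
    inH-W = Hbar-permute⁻ t W (permute-flip π X) inH
    moved : ∀ l → permute π (W ⊕ lookup R l) ≡ X ⊕ lookup (map (permute π) R) l
    moved l = trans (permute-⊕ π W (lookup R l))
                    (cong₂ _⊕_ (permute-flip π X) (sym (lookup-map l (permute π) R)))
    moveCoset : (∃ λ l → Hbar t (W ⊕ lookup R l) × Hbar s (W ⊕ lookup R l)) →
      ∃ λ l → Hbar (π ⟨$⟩ʳ t) (X ⊕ lookup (map (permute π) R) l)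
            × Hbar (π ⟨$⟩ʳ s) (X ⊕ lookup (map (permute π) R) l)
    moveCoset (l , inHt , inHs) =
      l , Hbar-permute⁺ t (W ⊕ lookup R l) (moved l) inHt , Hbar-permute⁺ s (W ⊕ lookup R l) (moved l) inHs

  inDistinctCosets-permute : ∀ t s {n} (R : Vec Word n) → InDistinctCosets t s R →
    InDistinctCosets (π ⟨$⟩ʳ t) (π ⟨$⟩ʳ s) (map (permute π) R)
  inDistinctCosets-permute t s R distinct l m inHt inHs =
    distinct l m (Hbar-permute⁻ t (lookup R l ⊕ lookup R m) moved inHt)
                 (Hbar-permute⁻ s (lookup R l ⊕ lookup R m) moved inHs)
    where
    moved : permute π (lookup R l ⊕ lookup R m)
          ≡ lookup (map (permute π) R) l ⊕ lookup (map (permute π) R) m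
    moved = trans (permute-⊕ π (lookup R l) (lookup R m))
                  (sym (cong₂ _⊕_ (lookup-map l (permute π) R) (lookup-map m (permute π) R)))

  transversal-permute : ∀ t s {n} (R : Vec Word n) → Transversal t s R →
    Transversal (π ⟨$⟩ʳ t) (π ⟨$⟩ʳ s) (map (permute π) R)
  transversal-permute t s R (light , meets , distinct) =
    (λ l → subst (LightInComponent (π ⟨$⟩ʳ t) (π ⟨$⟩ʳ s)) (sym (lookup-map l (permute π) R))
             (lightInComponent-permute t s (lookup R l) (light l))) ,
    meetsEveryCoset-permute t s R meets ,
    inDistinctCosets-permute t s R distinct

-- Opaque because unfolding affine a c c≢0 ⟨$⟩ʳ y into field arithmetic on
-- symbolic a and c during unification makes the type checker's terms explode.
opaque
  affine : (a c : F) → c ≢ 0F → Permutation′ 8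
  affine a c c≢0 = permutation (λ y → a +F (c *F y)) (λ x → (c ⁻¹) *F (x +F a))
    (affine-inverseˡ a c c≢0) (affine-inverseʳ a c c≢0)

  affine-cube-difference : ∀ a c (c≢0 : c ≢ 0F) y t →
    cube ((affine a c c≢0 ⟨$⟩ʳ y) +F (affine a c c≢0 ⟨$⟩ʳ t)) ≡ cube c *F cube (y +F t)
  affine-cube-difference a c c≢0 = cube-affine-difference a c

  affine-0 : ∀ a c (c≢0 : c ≢ 0F) → affine a c c≢0 ⟨$⟩ʳ 0F ≡ a
  affine-0 a c c≢0 = trans (cong (a +F_) (*F-zeroʳ c)) (+F-identityʳ a)

  affine-1 : ∀ a b (a+b≢0 : a +F b ≢ 0F) → affine a (a +F b) a+b≢0 ⟨$⟩ʳ 1F ≡ b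
  affine-1 a b a+b≢0 = trans (cong (a +F_) (*F-identityʳ (a +F b))) (+F-cancelˡ a b)

transversal-affine : ∀ a c (c≢0 : c ≢ 0F) t s {n} (R : Vec Word n) → Transversal t s R →
  Transversal (affine a c c≢0 ⟨$⟩ʳ t) (affine a c c≢0 ⟨$⟩ʳ s) (map (permute (affine a c c≢0)) R)
transversal-affine a c c≢0 =
  Transport.transversal-permute (affine a c c≢0) (cube c) (cube-≢0 c c≢0) (affine-cube-difference a c c≢0)

support : List F → Word
support xs = tabulate (λ x → does (x ∈? xs))

-- The weight-4 words of H̄₀ through 0 and 1 are {0,1,2,7}, {0,1,3,4} and
-- {0,1,5,6}; they sum to the all-ones word, which lies in H̄₀ ∩ H̄₁.
block₁ block₂ : Word
block₁ = support (# 0 ∷ # 1 ∷ # 2 ∷ # 7 ∷ [])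
block₂ = support (# 0 ∷ # 1 ∷ # 3 ∷ # 4 ∷ [])

base : Vec Word 4
base = zeroW ∷ block₁ ∷ block₂ ∷ block₁ ⊕ block₂ ∷ []

Hbar? : ∀ a X → Dec (Hbar a X)
Hbar? a X = (2 ∣? weight X) ×-dec (syndrome a X ≟ 0F)

base∈H₀ : (k : Fin 4) → Hbar 0F (lookup base k)
base∈H₀ = toWitness {a? = all? λ k → Hbar? 0F (lookup base k)} _

base-lightInComponent : (k : Fin 4) → LightInComponent 0F 1F (lookup base k)
base-lightInComponent zero = base∈H₀ zero , z≤n , here (base∈H₀ zero)
base-lightInComponent (suc zero) =
  base∈H₀ (# 1) , ≤-refl , step (here (base∈H₀ zero)) (base∈H₀ (# 1)) (refl , (λ ()) , (λ ()))
base-lightInComponent (suc (suc zero)) =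
  base∈H₀ (# 2) , ≤-refl , step (here (base∈H₀ zero)) (base∈H₀ (# 2)) (refl , (λ ()) , (λ ()))
base-lightInComponent (suc (suc (suc zero))) =
  base∈H₀ (# 3) , ≤-refl ,
  step (step {Z = block₁} (here (base∈H₀ zero)) (base∈H₀ (# 1)) (refl , (λ ()) , (λ ())))
       (base∈H₀ (# 3)) (refl , (λ ()) , (λ ()))

base-transversal : Transversal 0F 1F base
base-transversal =
  base-lightInComponent ,
  toWitness {a? = allSubset? λ X → Hbar? 0F X →-dec any? λ k →
                    Hbar? 0F (X ⊕ lookup base k) ×-dec Hbar? 1F (X ⊕ lookup base k)} _ ,
  toWitness {a? = all? λ k → all? λ l → Hbar? 0F (lookup base k ⊕ lookup base l) →-dec
                                        Hbar? 1F (lookup base k ⊕ lookup base l) →-dec k ≟ l} _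

transversal-exists : ∀ a b → a ≢ b → Σ ℕ λ n → Σ (Vec Word n) λ R → Transversal a b R
transversal-exists a b a≢b =
  4 , map (permute (affine a (a +F b) a+b≢0)) base ,
  moved {affine a (a +F b) a+b≢0 ⟨$⟩ʳ 0F} {affine a (a +F b) a+b≢0 ⟨$⟩ʳ 1F}
    (transversal-affine a (a +F b) a+b≢0 0F 1F base base-transversal)
    (affine-0 a (a +F b) a+b≢0) (affine-1 a b a+b≢0)
  where
  a+b≢0 : a +F b ≢ 0F
  a+b≢0 = +F-≢⇒≢0 a b a≢b
  -- Its implicit arguments are given above: left to unification they make
  -- Agda normalise Transversal u v … with u and v unknown, which explodes.
  moved : ∀ {u v} → Transversal u v (map (permute (affine a (a +F b) a+b≢0)) base) →
    u ≡ a → v ≡ b → Transversal a b (map (permute (affine a (a +F b) a+b≢0)) base)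
  moved T refl refl = T

primitive⇒≢0 : ∀ α → IsPrimitive α → α ≢ 0F
primitive⇒≢0 α (() , _) refl

primitive⇒≢1 : ∀ α → IsPrimitive α → α ≢ 1F
primitive⇒≢1 α (_ , order) refl = order 1 (s≤s z≤n) (s≤s (s≤s z≤n)) refl

powE-injective : ∀ α → α ≢ 0F → α ≢ 1F → ∀ i j → i ≢ j → powE α i ≢ powE α j
powE-injective α α≢0 α≢1 nothing  nothing  i≢j _    = i≢j refl
powE-injective α α≢0 α≢1 nothing  (just l) _   0≡αˡ = pow-≢0 α α≢0 l (sym 0≡αˡ)
powE-injective α α≢0 α≢1 (just k) nothing  _        = pow-≢0 α α≢0 k
powE-injective α α≢0 α≢1 (just k) (just l) i≢j      = i≢j ∘ cong just ∘ pow-injective α α≢0 α≢1 k l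

mainTheorem3 : (α : F) → IsPrimitive α → (i j : Exp) → i ≢ j →
    Σ ℕ λ n → Σ (Vec Word n) λ R →
      ((k : Fin n) →
          Hbar (powE α i) (lookup R k)
        × weight (lookup R k) ≤ 4
        × InComp (Hbar (powE α i)) (powE α i) (powE α j) zeroW (lookup R k))
    × ((X : Word) → Hbar (powE α i) X →
          ∃ λ (k : Fin n) → Hbar (powE α i) (X ⊕ lookup R k) × Hbar (powE α j) (X ⊕ lookup R k))
    × ((k l : Fin n) →
          Hbar (powE α i) (lookup R k ⊕ lookup R l) → Hbar (powE α j) (lookup R k ⊕ lookup R l) →
          k ≡ l)
mainTheorem3 α prim i j i≢j =
  transversal-exists (powE α i) (powE α j)
    (powE-injective α (primitive⇒≢0 α prim) (primitive⇒≢1 α prim) i j i≢j)
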